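{- Let $t_1,t_2$ be raw terms and let $t_1',t_2'$ be their respective $\rhd_\varepsilon$-normal forms (i.e. $t_k\rhd_\varepsilon^* t_k'$ and $t_k'$ admits no $\rhd_\varepsilon$-step). Then $t_1=_{\beta\varepsilon}t_2$ if and only if $t_1'=_\beta t_2'$.
   Context: Sorts are $\mathsf{Prop}$ and $\mathsf{Type}(i)$ for $i\in\mathbb N$. Tags are $*$ and $\diamond$; every variable carries a tag. Raw terms are generated by $t ::= s \mid x_{\mathsf s} \mid \lambda x_{\mathsf s}:t.\,t \mid (t\;t) \mid \Pi x_{\mathsf s}:t.\,t \mid \Sigma^{\mathsf s} x_{\mathsf s}:t.\,t \mid \langle t,t\rangle_{\Sigma^{\mathsf s}x_{\mathsf s}:t.\,t} \mid \pi_1(t) \mid \pi_2^{\mathsf s}(t) \mid \varepsilon$ ($s$ a sort, $\mathsf s$ a tag, $\varepsilon$ a constant), up to $\alpha$-conversion; contextual closure means rewriting at any subterm. Extraction $\rhd_\varepsilon$ is the contextual closure of $x_*\rhd_\varepsilon\varepsilon$, $\lambda x:A.\varepsilon\rhd_\varepsilon\varepsilon$, $(\varepsilon\;t)\rhd_\varepsilon\varepsilon$, $\pi_2^*(t)\rhd_\varepsilon\varepsilon$; $\rhd_\varepsilon^*$ is its reflexive-transitive closure. The tag $s(t)$ is $*$ if $t\rhd_\varepsilon^*\varepsilon$ and $\diamond$ otherwise. $\rhd_\beta$ is the contextual closure of $((\lambda x_{\mathsf s}:A.t)\;u)\rhd_\beta t[x_{\mathsf s}\setminus u]$ if $s(u)=\mathsf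 s$; $\pi_1(\langle a,b\rangle_{\Sigma^{\mathsf s'}x:A.B})\rhd_\beta a$ if $s(a)=\diamond$; $\pi_2^{\mathsf s}(\langle a,b\rangle_{\Sigma^{\mathsf s'}x:A.B})\rhd_\beta b$ if $s(b)=\mathsf s$. $=_\beta$ is the reflexive-symmetric-transitive closure of $\rhd_\beta$; $=_{\beta\varepsilon}$ is the reflexive-symmetric-transitive closure of $\rhd_\beta\cup\rhd_\varepsilon$. -}

module Defs where

open import Data.Nat using (ℕ; zero; suc)
open import Data.Sum using (_⊎_)
open import Relation.Nullary using (¬_)
open import Relation.Binary.Construct.Closure.ReflexiveTransitive using (Star)
open import Relation.Binary.Construct.Closure.Equivalence using (EqClosure)

data Tag : Set where
  star diamond : Tag

data Sort : Set where
  Prop : Sort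
  Type : ℕ → Sort

-- Raw terms up to α-conversion.  Variables are named by a pair (name, tag);
-- we use de Bruijn indices with ONE INDEX SPACE PER TAG: `var s n` refers to
-- the n-th enclosing binder of tag s (indices beyond the binders are free
-- variables of tag s).  A binder of tag s only binds in the s-namespace.
data Term : Set where
  sort : Sort → Term
  var  : Tag → ℕ → Term
  lam  : Tag → Term → Term → Term
  app  : Term → Term → Term
  pi   : Tag → Term → Term → Term
  sig  : Tag → Tag → Term → Term → Term    -- Σ^s x_{s'} : A . B  (args s s'; B under s')
  pair : Term → Term → Tag → Tag → Term → Term → Term
    -- ⟨a , b⟩_{Σ^s x_{s'} : A . B}  (args a b s s' A B; B under s')
  pi1  : Term → Term
  pi2  : Tag → Term → Term
  eps  : Term

Ren : Set
Ren = Tag → ℕ → ℕ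

Sub : Set
Sub = Tag → ℕ → Term

extR : Tag → Ren → Ren
extR star    ρ star    zero    = zero
extR star    ρ star    (suc n) = suc (ρ star n)
extR diamond ρ diamond zero    = zero
extR diamond ρ diamond (suc n) = suc (ρ diamond n)
extR star    ρ diamond n       = ρ diamond n
extR diamond ρ star    n       = ρ star n

rename : Ren → Term → Term
rename ρ (sort s) = sort s
rename ρ (var s n) = var s (ρ s n)
rename ρ (lam s A t) = lam s (rename ρ A) (rename (extR s ρ) t)
rename ρ (app t u) = app (rename ρ t) (rename ρ u)
rename ρ (pi s A B) = pi s (rename ρ A) (rename (extR s ρ) B)
rename ρ (sig s s' A B) = sig s s' (rename ρ A) (rename (extR s' ρ) B)
rename ρ (pair a b s s' A B) =
  pair (rename ρ a) (rename ρ b) s s' (rename ρ A) (rename (extR s' ρ) B)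
rename ρ (pi1 t) = pi1 (rename ρ t)
rename ρ (pi2 s t) = pi2 s (rename ρ t)
rename ρ eps = eps

up : Tag → Ren
up star    star    n = suc n
up star    diamond n = n
up diamond diamond n = suc n
up diamond star    n = n

weaken : Tag → Term → Term
weaken b = rename (up b)

extS : Tag → Sub → Sub
extS star    σ star    zero    = var star zero
extS star    σ star    (suc n) = weaken star (σ star n)
extS diamond σ diamond zero    = var diamond zero
extS diamond σ diamond (suc n) = weaken diamond (σ diamond n)
extS star    σ diamond n       = weaken star (σ diamond n)
extS diamond σ star    n       = weaken diamond (σ star n)

subst : Sub → Term → Term
subst σ (sort s) = sort s
subst σ (var s n) = σ s n
subst σ (lam s A t) = lam s (subst σ A) (subst (extS s σ) t)
subst σ (app t u) = app (subst σ t) (subst σ u)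
subst σ (pi s A B) = pi s (subst σ A) (subst (extS s σ) B)
subst σ (sig s s' A B) = sig s s' (subst σ A) (subst (extS s' σ) B)
subst σ (pair a b s s' A B) =
  pair (subst σ a) (subst σ b) s s' (subst σ A) (subst (extS s' σ) B)
subst σ (pi1 t) = pi1 (subst σ t)
subst σ (pi2 s t) = pi2 s (subst σ t)
subst σ eps = eps

single : Tag → Term → Sub
single star    u star    zero    = u
single star    u star    (suc n) = var star n
single diamond u diamond zero    = u
single diamond u diamond (suc n) = var diamond n
single star    u diamond n       = var diamond n
single diamond u star    n       = var star n

_[_≔_] : Term → Tag → Term → Term
t [ b ≔ u ] = subst (single b u) t

data Ctx (R : Term → Term → Set) : Term → Term → Set where
  base  : ∀ {t u} → R t u → Ctx R t u
  lamA  : ∀ {s A A' t} → Ctx R A A' → Ctx R (lam s A t) (lam s A' t)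
  lamt  : ∀ {s A t t'} → Ctx R t t' → Ctx R (lam s A t) (lam s A t')
  appl  : ∀ {t t' u} → Ctx R t t' → Ctx R (app t u) (app t' u)
  appr  : ∀ {t u u'} → Ctx R u u' → Ctx R (app t u) (app t u')
  piA   : ∀ {s A A' B} → Ctx R A A' → Ctx R (pi s A B) (pi s A' B)
  piB   : ∀ {s A B B'} → Ctx R B B' → Ctx R (pi s A B) (pi s A B')
  sigA  : ∀ {s s' A A' B} → Ctx R A A' → Ctx R (sig s s' A B) (sig s s' A' B)
  sigB  : ∀ {s s' A B B'} → Ctx R B B' → Ctx R (sig s s' A B) (sig s s' A B')
  paira : ∀ {a a' b s s' A B} → Ctx R a a' →
          Ctx R (pair a b s s' A B) (pair a' b s s' A B)
  pairb : ∀ {a b b' s s' A B} → Ctx R b b' →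
          Ctx R (pair a b s s' A B) (pair a b' s s' A B)
  pairA : ∀ {a b s s' A A' B} → Ctx R A A' →
          Ctx R (pair a b s s' A B) (pair a b s s' A' B)
  pairB : ∀ {a b s s' A B B'} → Ctx R B B' →
          Ctx R (pair a b s s' A B) (pair a b s s' A B')
  pi1c  : ∀ {t t'} → Ctx R t t' → Ctx R (pi1 t) (pi1 t')
  pi2c  : ∀ {s t t'} → Ctx R t t' → Ctx R (pi2 s t) (pi2 s t')

data EpsBase : Term → Term → Set where
  e-var : ∀ {n} → EpsBase (var star n) eps
  e-lam : ∀ {s A} → EpsBase (lam s A eps) eps
  e-app : ∀ {t} → EpsBase (app eps t) eps
  e-pi2 : ∀ {t} → EpsBase (pi2 star t) eps

_▷ε_ : Term → Term → Set
_▷ε_ = Ctx EpsBase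

_▷ε*_ : Term → Term → Set
_▷ε*_ = Star _▷ε_

ε-normal : Term → Set
ε-normal t = ∀ u → ¬ (t ▷ε u)

-- s(t) = 𝗌 : the tag of t is * iff t ▷ε* ε, ◇ otherwise
HasTag : Term → Tag → Set
HasTag t star    = t ▷ε* eps
HasTag t diamond = ¬ (t ▷ε* eps)

data BetaBase : Term → Term → Set where
  b-lam : ∀ {s A t u} → HasTag u s → BetaBase (app (lam s A t) u) (t [ s ≔ u ])
  b-pi1 : ∀ {a b s s' A B} → HasTag a diamond →
          BetaBase (pi1 (pair a b s s' A B)) a
  b-pi2 : ∀ {s a b s₁ s' A B} → HasTag b s →
          BetaBase (pi2 s (pair a b s₁ s' A B)) b

_▷β_ : Term → Term → Set
_▷β_ = Ctx BetaBase

_=β_ : Term → Term → Set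
_=β_ = EqClosure _▷β_

data BetaEpsBase : Term → Term → Set where
  be-β : ∀ {t u} → BetaBase t u → BetaEpsBase t u
  be-ε : ∀ {t u} → EpsBase t u → BetaEpsBase t u

-- ▷β ∪ ▷ε  (= contextual closure of the union of the base rules)
_▷βε_ : Term → Term → Set
_▷βε_ = Ctx BetaEpsBase

_=βε_ : Term → Term → Set
_=βε_ = EqClosure _▷βε_

module Submission where

-- Every term has a unique ▷ε-normal form, and it can be computed
-- structurally: `nf` performs the four extraction rules bottom-up,
-- through the smart constructors `mkLam` and `mkApp`.  The development is:
--   1. t ▷ε* nf t, and nf is invariant under ▷ε; hence every ε-normal form
--      of t equals nf t, and the tag of t is read off nf t (s(t) = * iff
--      nf t = ε).
--   2. nf commutes with renamings, and with substitutions whose *-entries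
--      extract to ε (the "extraction" of a substitution).
--   3. Using 2, a β-step t ▷β u projects to at most one β-step
--      nf t ▷β nf u (which moreover never produces ε).
-- So a βε-conversion t₁ =βε t₂ maps under nf to nf t₁ =β nf t₂; conversely
-- t₁' =β t₂' lifts back, since t_k ▷ε* t_k' are βε-conversions.

open import Defs
open import Data.Nat using (zero; suc)
open import Function.Bundles using (_⇔_; mk⇔)
open import Data.Sum using (_⊎_; inj₁; inj₂) renaming (map to ⊎-map)
open import Data.Product using (_×_; _,_)
open import Data.Empty using (⊥-elim)
open import Relation.Nullary using (¬_)
open import Relation.Binary.PropositionalEquality
  using (_≡_; _≢_; refl; sym; trans; cong; cong₂)
  renaming (subst to ≡-subst)
open import Relation.Binary.Construct.Closure.ReflexiveTransitive
  using (ε; _◅_; _◅◅_) renaming (gmap to Star-gmap)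
open import Relation.Binary.Construct.Closure.Symmetric using (fwd)
open import Relation.Binary.Construct.Closure.Equivalence
  using (isEquivalence; symmetric)
  renaming (gfold to EqClosure-gfold; gmap to EqClosure-gmap)

Ctx-map : ∀ {R S : Term → Term → Set} → (∀ {a b} → R a b → S a b) →
          ∀ {x y} → Ctx R x y → Ctx S x y
Ctx-map f (base r)  = base (f r)
Ctx-map f (lamA r)  = lamA (Ctx-map f r)
Ctx-map f (lamt r)  = lamt (Ctx-map f r)
Ctx-map f (appl r)  = appl (Ctx-map f r)
Ctx-map f (appr r)  = appr (Ctx-map f r)
Ctx-map f (piA r)   = piA (Ctx-map f r)
Ctx-map f (piB r)   = piB (Ctx-map f r)
Ctx-map f (sigA r)  = sigA (Ctx-map f r)
Ctx-map f (sigB r)  = sigB (Ctx-map f r)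
Ctx-map f (paira r) = paira (Ctx-map f r)
Ctx-map f (pairb r) = pairb (Ctx-map f r)
Ctx-map f (pairA r) = pairA (Ctx-map f r)
Ctx-map f (pairB r) = pairB (Ctx-map f r)
Ctx-map f (pi1c r)  = pi1c (Ctx-map f r)
Ctx-map f (pi2c r)  = pi2c (Ctx-map f r)

▷βε-split : ∀ {x y} → x ▷βε y → (x ▷β y) ⊎ (x ▷ε y)
▷βε-split (base (be-β r)) = inj₁ (base r)
▷βε-split (base (be-ε r)) = inj₂ (base r)
▷βε-split (lamA r)  = ⊎-map lamA lamA (▷βε-split r)
▷βε-split (lamt r)  = ⊎-map lamt lamt (▷βε-split r)
▷βε-split (appl r)  = ⊎-map appl appl (▷βε-split r)
▷βε-split (appr r)  = ⊎-map appr appr (▷βε-split r)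
▷βε-split (piA r)   = ⊎-map piA piA (▷βε-split r)
▷βε-split (piB r)   = ⊎-map piB piB (▷βε-split r)
▷βε-split (sigA r)  = ⊎-map sigA sigA (▷βε-split r)
▷βε-split (sigB r)  = ⊎-map sigB sigB (▷βε-split r)
▷βε-split (paira r) = ⊎-map paira paira (▷βε-split r)
▷βε-split (pairb r) = ⊎-map pairb pairb (▷βε-split r)
▷βε-split (pairA r) = ⊎-map pairA pairA (▷βε-split r)
▷βε-split (pairB r) = ⊎-map pairB pairB (▷βε-split r)
▷βε-split (pi1c r)  = ⊎-map pi1c pi1c (▷βε-split r)
▷βε-split (pi2c r)  = ⊎-map pi2c pi2c (▷βε-split r)

▷ε*⇒=βε : ∀ {t t'} → t ▷ε* t' → t =βε t'
▷ε*⇒=βε = Star-gmap (λ x → x) (λ r → fwd (Ctx-map be-ε r))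

eps? : ∀ t → t ≡ eps ⊎ t ≢ eps
eps? eps                  = inj₁ refl
eps? (sort _)             = inj₂ (λ ())
eps? (var _ _)            = inj₂ (λ ())
eps? (lam _ _ _)          = inj₂ (λ ())
eps? (app _ _)            = inj₂ (λ ())
eps? (pi _ _ _)           = inj₂ (λ ())
eps? (sig _ _ _ _)        = inj₂ (λ ())
eps? (pair _ _ _ _ _ _)   = inj₂ (λ ())
eps? (pi1 _)              = inj₂ (λ ())
eps? (pi2 _ _)            = inj₂ (λ ())

mkLam : Tag → Term → Term → Term
mkLam s A eps = eps
mkLam s A t   = lam s A t

mkApp : Term → Term → Term
mkApp eps u = eps
mkApp t   u = app t u

mkLam-non-eps : ∀ s A t → t ≢ eps → mkLam s A t ≡ lam s A t
mkLam-non-eps s A eps                ne = ⊥-elim (ne refl)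
mkLam-non-eps s A (sort _)           ne = refl
mkLam-non-eps s A (var _ _)          ne = refl
mkLam-non-eps s A (lam _ _ _)        ne = refl
mkLam-non-eps s A (app _ _)          ne = refl
mkLam-non-eps s A (pi _ _ _)         ne = refl
mkLam-non-eps s A (sig _ _ _ _)      ne = refl
mkLam-non-eps s A (pair _ _ _ _ _ _) ne = refl
mkLam-non-eps s A (pi1 _)            ne = refl
mkLam-non-eps s A (pi2 _ _)          ne = refl

mkApp-non-eps : ∀ t u → t ≢ eps → mkApp t u ≡ app t u
mkApp-non-eps eps                u ne = ⊥-elim (ne refl)
mkApp-non-eps (sort _)           u ne = refl
mkApp-non-eps (var _ _)          u ne = refl
mkApp-non-eps (lam _ _ _)        u ne = refl
mkApp-non-eps (app _ _)          u ne = refl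
mkApp-non-eps (pi _ _ _)         u ne = refl
mkApp-non-eps (sig _ _ _ _)      u ne = refl
mkApp-non-eps (pair _ _ _ _ _ _) u ne = refl
mkApp-non-eps (pi1 _)            u ne = refl
mkApp-non-eps (pi2 _ _)          u ne = refl

nf : Term → Term
nf (sort s)            = sort s
nf (var star n)        = eps
nf (var diamond n)     = var diamond n
nf (lam s A t)         = mkLam s (nf A) (nf t)
nf (app t u)           = mkApp (nf t) (nf u)
nf (pi s A B)          = pi s (nf A) (nf B)
nf (sig s s' A B)      = sig s s' (nf A) (nf B)
nf (pair a b s s' A B) = pair (nf a) (nf b) s s' (nf A) (nf B)
nf (pi1 t)             = pi1 (nf t)
nf (pi2 star t)        = eps
nf (pi2 diamond t)     = pi2 diamond (nf t)
nf eps                 = eps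

-- Part 1: nf is the ε-normal form.

mkLam-reachable : ∀ s A t → lam s A t ▷ε* mkLam s A t
mkLam-reachable s A t with eps? t
... | inj₁ refl = base e-lam ◅ ε
... | inj₂ ne rewrite mkLam-non-eps s A t ne = ε

mkApp-reachable : ∀ t u → app t u ▷ε* mkApp t u
mkApp-reachable t u with eps? t
... | inj₁ refl = base e-app ◅ ε
... | inj₂ ne rewrite mkApp-non-eps t u ne = ε

▷ε*-nf : ∀ t → t ▷ε* nf t
▷ε*-nf (sort _)          = ε
▷ε*-nf (var star n)      = base e-var ◅ ε
▷ε*-nf (var diamond n)   = ε
▷ε*-nf (lam s A t) =
  Star-gmap (λ X → lam s X t) lamA (▷ε*-nf A) ◅◅
  Star-gmap (lam s (nf A)) lamt (▷ε*-nf t) ◅◅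
  mkLam-reachable s (nf A) (nf t)
▷ε*-nf (app t u) =
  Star-gmap (λ X → app X u) appl (▷ε*-nf t) ◅◅
  Star-gmap (app (nf t)) appr (▷ε*-nf u) ◅◅
  mkApp-reachable (nf t) (nf u)
▷ε*-nf (pi s A B) =
  Star-gmap (λ X → pi s X B) piA (▷ε*-nf A) ◅◅
  Star-gmap (pi s (nf A)) piB (▷ε*-nf B)
▷ε*-nf (sig s s' A B) =
  Star-gmap (λ X → sig s s' X B) sigA (▷ε*-nf A) ◅◅
  Star-gmap (sig s s' (nf A)) sigB (▷ε*-nf B)
▷ε*-nf (pair a b s s' A B) =
  Star-gmap (λ X → pair X b s s' A B) paira (▷ε*-nf a) ◅◅
  Star-gmap (λ X → pair (nf a) X s s' A B) pairb (▷ε*-nf b) ◅◅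
  Star-gmap (λ X → pair (nf a) (nf b) s s' X B) pairA (▷ε*-nf A) ◅◅
  Star-gmap (pair (nf a) (nf b) s s' (nf A)) pairB (▷ε*-nf B)
▷ε*-nf (pi1 t)           = Star-gmap pi1 pi1c (▷ε*-nf t)
▷ε*-nf (pi2 star t)      = base e-pi2 ◅ ε
▷ε*-nf (pi2 diamond t)   = Star-gmap (pi2 diamond) pi2c (▷ε*-nf t)
▷ε*-nf eps               = ε

-- nf is invariant under extraction steps (this is where confluence lives).
nf-▷ε : ∀ {t u} → t ▷ε u → nf t ≡ nf u
nf-▷ε (base e-var) = refl
nf-▷ε (base e-lam) = refl
nf-▷ε (base e-app) = refl
nf-▷ε (base e-pi2) = refl
nf-▷ε {lam s _ t} (lamA r) = cong (λ X → mkLam s X (nf t)) (nf-▷ε r)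
nf-▷ε {lam s A _} (lamt r) = cong (mkLam s (nf A)) (nf-▷ε r)
nf-▷ε {app _ u}   (appl r) = cong (λ X → mkApp X (nf u)) (nf-▷ε r)
nf-▷ε {app t _}   (appr r) = cong (mkApp (nf t)) (nf-▷ε r)
nf-▷ε (piA r)  = cong₂ (pi _) (nf-▷ε r) refl
nf-▷ε (piB r)  = cong₂ (pi _) refl (nf-▷ε r)
nf-▷ε (sigA r) = cong₂ (sig _ _) (nf-▷ε r) refl
nf-▷ε (sigB r) = cong₂ (sig _ _) refl (nf-▷ε r)
nf-▷ε {pair _ b s s' A B} (paira r) = cong (λ X → pair X (nf b) s s' (nf A) (nf B)) (nf-▷ε r)
nf-▷ε {pair a _ s s' A B} (pairb r) = cong (λ X → pair (nf a) X s s' (nf A) (nf B)) (nf-▷ε r)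
nf-▷ε {pair a b s s' _ B} (pairA r) = cong (λ X → pair (nf a) (nf b) s s' X (nf B)) (nf-▷ε r)
nf-▷ε {pair a b s s' A _} (pairB r) = cong (pair (nf a) (nf b) s s' (nf A)) (nf-▷ε r)
nf-▷ε (pi1c r) = cong pi1 (nf-▷ε r)
nf-▷ε {pi2 star _}    (pi2c r) = refl
nf-▷ε {pi2 diamond _} (pi2c r) = cong (pi2 diamond) (nf-▷ε r)

nf-▷ε* : ∀ {t u} → t ▷ε* u → nf t ≡ nf u
nf-▷ε* ε        = refl
nf-▷ε* (r ◅ rs) = trans (nf-▷ε r) (nf-▷ε* rs)

nf-of-ε-normal : ∀ t → ε-normal t → nf t ≡ t
nf-of-ε-normal t normal = empty (▷ε*-nf t)
  where
  empty : ∀ {u} → t ▷ε* u → u ≡ t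
  empty ε       = refl
  empty (r ◅ _) = ⊥-elim (normal _ r)

ε-normal-form≡nf : ∀ {t t'} → t ▷ε* t' → ε-normal t' → t' ≡ nf t
ε-normal-form≡nf {t} {t'} r normal =
  trans (sym (nf-of-ε-normal t' normal)) (sym (nf-▷ε* r))

star⇒nf≡eps : ∀ {u} → HasTag u star → nf u ≡ eps
star⇒nf≡eps = nf-▷ε*

diamond⇒nf≢eps : ∀ {u} → HasTag u diamond → nf u ≢ eps
diamond⇒nf≢eps {u} h e = h (≡-subst (u ▷ε*_) e (▷ε*-nf u))

nf-preserves-tag : ∀ {u} s → HasTag u s → HasTag (nf u) s
nf-preserves-tag star    h = ≡-subst (_▷ε* eps) (sym (star⇒nf≡eps h)) ε
nf-preserves-tag {u} diamond h r = h (▷ε*-nf u ◅◅ r)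

-- Part 2: nf commutes with renaming and substitution.

rename-non-eps : ∀ ρ t → t ≢ eps → rename ρ t ≢ eps
rename-non-eps ρ eps                ne = ⊥-elim (ne refl)
rename-non-eps ρ (sort _)           ne = λ ()
rename-non-eps ρ (var _ _)          ne = λ ()
rename-non-eps ρ (lam _ _ _)        ne = λ ()
rename-non-eps ρ (app _ _)          ne = λ ()
rename-non-eps ρ (pi _ _ _)         ne = λ ()
rename-non-eps ρ (sig _ _ _ _)      ne = λ ()
rename-non-eps ρ (pair _ _ _ _ _ _) ne = λ ()
rename-non-eps ρ (pi1 _)            ne = λ ()
rename-non-eps ρ (pi2 _ _)          ne = λ ()

rename-mkLam : ∀ ρ s A t →
  mkLam s (rename ρ A) (rename (extR s ρ) t) ≡ rename ρ (mkLam s A t)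
rename-mkLam ρ s A t with eps? t
... | inj₁ refl = refl
... | inj₂ ne rewrite mkLam-non-eps s A t ne
                    | mkLam-non-eps s (rename ρ A) (rename (extR s ρ) t)
                                    (rename-non-eps _ t ne) = refl

rename-mkApp : ∀ ρ t u → mkApp (rename ρ t) (rename ρ u) ≡ rename ρ (mkApp t u)
rename-mkApp ρ t u with eps? t
... | inj₁ refl = refl
... | inj₂ ne rewrite mkApp-non-eps t u ne
                    | mkApp-non-eps (rename ρ t) (rename ρ u) (rename-non-eps _ t ne) = refl

-- Extraction commutes with renaming (needed to push substitutions under binders).
nf-rename : ∀ ρ t → nf (rename ρ t) ≡ rename ρ (nf t)
nf-rename ρ (sort _)        = refl
nf-rename ρ (var star n)    = refl
nf-rename ρ (var diamond n) = refl
nf-rename ρ (lam s A t) rewrite nf-rename ρ A | nf-rename (extR s ρ) t =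
  rename-mkLam ρ s (nf A) (nf t)
nf-rename ρ (app t u) rewrite nf-rename ρ t | nf-rename ρ u =
  rename-mkApp ρ (nf t) (nf u)
nf-rename ρ (pi s A B) rewrite nf-rename ρ A | nf-rename (extR s ρ) B = refl
nf-rename ρ (sig s s' A B) rewrite nf-rename ρ A | nf-rename (extR s' ρ) B = refl
nf-rename ρ (pair a b s s' A B)
  rewrite nf-rename ρ a | nf-rename ρ b | nf-rename ρ A | nf-rename (extR s' ρ) B = refl
nf-rename ρ (pi1 t) rewrite nf-rename ρ t = refl
nf-rename ρ (pi2 star t)    = refl
nf-rename ρ (pi2 diamond t) rewrite nf-rename ρ t = refl
nf-rename ρ eps             = refl

nf≢var-star : ∀ t n → nf t ≢ var star n
nf≢var-star (sort _)           n = λ ()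
nf≢var-star (var star _)       n = λ ()
nf≢var-star (var diamond _)    n = λ ()
nf≢var-star (lam s A t)        n with eps? (nf t)
... | inj₁ e rewrite e = λ ()
... | inj₂ ne rewrite mkLam-non-eps s (nf A) (nf t) ne = λ ()
nf≢var-star (app t u)          n with eps? (nf t)
... | inj₁ e rewrite e = λ ()
... | inj₂ ne rewrite mkApp-non-eps (nf t) (nf u) ne = λ ()
nf≢var-star (pi _ _ _)         n = λ ()
nf≢var-star (sig _ _ _ _)      n = λ ()
nf≢var-star (pair _ _ _ _ _ _) n = λ ()
nf≢var-star (pi1 _)            n = λ ()
nf≢var-star (pi2 star _)       n = λ ()
nf≢var-star (pi2 diamond _)    n = λ ()
nf≢var-star eps                n = λ ()

NonEps◇ : Sub → Set
NonEps◇ τ = ∀ n → τ diamond n ≢ eps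

extS-NonEps◇ : ∀ b τ → NonEps◇ τ → NonEps◇ (extS b τ)
extS-NonEps◇ star    τ g n       = rename-non-eps _ (τ diamond n) (g n)
extS-NonEps◇ diamond τ g zero    = λ ()
extS-NonEps◇ diamond τ g (suc n) = rename-non-eps _ (τ diamond n) (g n)

-- Such a substitution cannot turn a non-ε normal form into ε: the only
-- variables in a normal form are ◇-variables.
subst-nf-non-eps : ∀ τ → NonEps◇ τ → ∀ t → nf t ≢ eps → subst τ (nf t) ≢ eps
subst-nf-non-eps τ g t ne = go (nf t) ne (nf≢var-star t)
  where
  go : ∀ x → x ≢ eps → (∀ n → x ≢ var star n) → subst τ x ≢ eps
  go eps                ne nv = ⊥-elim (ne refl)
  go (var star n)       ne nv = ⊥-elim (nv n refl)
  go (var diamond n)    ne nv = g n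
  go (sort _)           ne nv = λ ()
  go (lam _ _ _)        ne nv = λ ()
  go (app _ _)          ne nv = λ ()
  go (pi _ _ _)         ne nv = λ ()
  go (sig _ _ _ _)      ne nv = λ ()
  go (pair _ _ _ _ _ _) ne nv = λ ()
  go (pi1 _)            ne nv = λ ()
  go (pi2 _ _)          ne nv = λ ()

subst-mkLam : ∀ τ → NonEps◇ τ → ∀ s A t →
  mkLam s (subst τ A) (subst (extS s τ) (nf t)) ≡ subst τ (mkLam s A (nf t))
subst-mkLam τ g s A t with eps? (nf t)
... | inj₁ e rewrite e = refl
... | inj₂ ne rewrite mkLam-non-eps s A (nf t) ne
                    | mkLam-non-eps s (subst τ A) (subst (extS s τ) (nf t))
                        (subst-nf-non-eps (extS s τ) (extS-NonEps◇ s τ g) t ne) = refl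

subst-mkApp : ∀ τ → NonEps◇ τ → ∀ t u →
  mkApp (subst τ (nf t)) (subst τ u) ≡ subst τ (mkApp (nf t) u)
subst-mkApp τ g t u with eps? (nf t)
... | inj₁ e rewrite e = refl
... | inj₂ ne rewrite mkApp-non-eps (nf t) u ne
                    | mkApp-non-eps (subst τ (nf t)) (subst τ u)
                        (subst-nf-non-eps τ g t ne) = refl

record Extracts (σ τ : Sub) : Set where
  field
    star-entries    : ∀ n → nf (σ star n) ≡ eps
    diamond-entries : ∀ n → nf (σ diamond n) ≡ τ diamond n
    non-eps         : NonEps◇ τ
open Extracts

extS-Extracts : ∀ b {σ τ} → Extracts σ τ → Extracts (extS b σ) (extS b τ)
extS-Extracts star {σ} {τ} E = record
  { star-entries    = stars
  ; diamond-entries = λ n → trans (nf-rename _ (σ diamond n)) (cong (rename _) (diamond-entries E n))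
  ; non-eps         = extS-NonEps◇ star τ (non-eps E) }
  where
  stars : ∀ n → nf (extS star σ star n) ≡ eps
  stars zero    = refl
  stars (suc n) = trans (nf-rename _ (σ star n)) (cong (rename _) (star-entries E n))
extS-Extracts diamond {σ} {τ} E = record
  { star-entries    = λ n → trans (nf-rename _ (σ star n)) (cong (rename _) (star-entries E n))
  ; diamond-entries = diamonds
  ; non-eps         = extS-NonEps◇ diamond τ (non-eps E) }
  where
  diamonds : ∀ n → nf (extS diamond σ diamond n) ≡ extS diamond τ diamond n
  diamonds zero    = refl
  diamonds (suc n) = trans (nf-rename _ (σ diamond n)) (cong (rename _) (diamond-entries E n))

nf-subst : ∀ {σ τ} → Extracts σ τ → ∀ t → nf (subst σ t) ≡ subst τ (nf t)
nf-subst E (sort _)        = refl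
nf-subst E (var star n)    = star-entries E n
nf-subst E (var diamond n) = diamond-entries E n
nf-subst {σ} {τ} E (lam s A t) rewrite nf-subst E A | nf-subst (extS-Extracts s E) t =
  subst-mkLam τ (non-eps E) s (nf A) t
nf-subst {σ} {τ} E (app t u) rewrite nf-subst E t | nf-subst E u =
  subst-mkApp τ (non-eps E) t (nf u)
nf-subst E (pi s A B) rewrite nf-subst E A | nf-subst (extS-Extracts s E) B = refl
nf-subst E (sig s s' A B) rewrite nf-subst E A | nf-subst (extS-Extracts s' E) B = refl
nf-subst E (pair a b s s' A B)
  rewrite nf-subst E a | nf-subst E b | nf-subst E A | nf-subst (extS-Extracts s' E) B = refl
nf-subst E (pi1 t) rewrite nf-subst E t = refl
nf-subst E (pi2 star t)    = refl
nf-subst E (pi2 diamond t) rewrite nf-subst E t = refl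
nf-subst E eps             = refl

single-Extracts : ∀ s u → HasTag u s → Extracts (single s u) (single s (nf u))
single-Extracts star u h = record
  { star-entries = stars ; diamond-entries = λ _ → refl ; non-eps = λ _ () }
  where
  stars : ∀ n → nf (single star u star n) ≡ eps
  stars zero    = star⇒nf≡eps h
  stars (suc n) = refl
single-Extracts diamond u h = record
  { star-entries = λ _ → refl ; diamond-entries = diamonds ; non-eps = non-eps' }
  where
  diamonds : ∀ n → nf (single diamond u diamond n) ≡ single diamond (nf u) diamond n
  diamonds zero    = refl
  diamonds (suc n) = refl
  non-eps' : NonEps◇ (single diamond (nf u))
  non-eps' zero    = diamond⇒nf≢eps h
  non-eps' (suc n) = λ ()

-- Part 3: projecting β-steps onto normal forms.

-- Zero or one β-step, where a genuine step never produces ε; this side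
-- condition lets a step in a body survive the smart constructors.
_▷β?_ : Term → Term → Set
x ▷β? y = x ≡ y ⊎ (x ▷β y × y ≢ eps)

eps-β-normal : ∀ {y} → ¬ (eps ▷β y)
eps-β-normal (base ())

▷β-source-non-eps : ∀ {x y} → x ▷β y → x ≢ eps
▷β-source-non-eps r refl = eps-β-normal r

▷β?-cong : (f : Term → Term) → (∀ {a b} → a ▷β b → f a ▷β f b) → (∀ a → f a ≢ eps) →
           ∀ {x y} → x ▷β? y → f x ▷β? f y
▷β?-cong f step non-eps (inj₁ refl)    = inj₁ refl
▷β?-cong f step non-eps (inj₂ (r , _)) = inj₂ (step r , non-eps _)

mkLam-▷β?-body : ∀ s A {t t'} → t ▷β? t' → mkLam s A t ▷β? mkLam s A t'
mkLam-▷β?-body s A (inj₁ refl) = inj₁ refl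
mkLam-▷β?-body s A {t} {t'} (inj₂ (r , ne'))
  rewrite mkLam-non-eps s A t (▷β-source-non-eps r) | mkLam-non-eps s A t' ne' =
  inj₂ (lamt r , λ ())

mkLam-▷β?-type : ∀ s t {A A'} → A ▷β? A' → mkLam s A t ▷β? mkLam s A' t
mkLam-▷β?-type s t {A} {A'} r with eps? t
... | inj₁ refl = inj₁ refl
... | inj₂ ne rewrite mkLam-non-eps s A t ne | mkLam-non-eps s A' t ne =
  ▷β?-cong (λ X → lam s X t) lamA (λ _ ()) r

mkApp-▷β?-head : ∀ u {t t'} → t ▷β? t' → mkApp t u ▷β? mkApp t' u
mkApp-▷β?-head u (inj₁ refl) = inj₁ refl
mkApp-▷β?-head u {t} {t'} (inj₂ (r , ne'))
  rewrite mkApp-non-eps t u (▷β-source-non-eps r) | mkApp-non-eps t' u ne' =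
  inj₂ (appl r , λ ())

mkApp-▷β?-arg : ∀ t {u u'} → u ▷β? u' → mkApp t u ▷β? mkApp t u'
mkApp-▷β?-arg t {u} {u'} r with eps? t
... | inj₁ refl = inj₁ refl
... | inj₂ ne rewrite mkApp-non-eps t u ne | mkApp-non-eps t u' ne =
  ▷β?-cong (app t) appr (λ _ ()) r

-- A root β-redex (λx_s:A.t) u with s(u) = s: its normal form is ε exactly
-- when nf t is; otherwise it is again a β-redex, contracting to nf (t[x_s ≔ u]).
nf-β-redex : ∀ {s A t u} → HasTag u s →
             nf (app (lam s A t) u) ▷β? nf (t [ s ≔ u ])
nf-β-redex {s} {A} {t} {u} h rewrite nf-subst (single-Extracts s u h) t with eps? (nf t)
... | inj₁ e rewrite e = inj₁ refl
... | inj₂ ne rewrite mkLam-non-eps s (nf A) (nf t) ne =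
  inj₂ ( base (b-lam (nf-preserves-tag s h))
       , subst-nf-non-eps _ (non-eps (single-Extracts s u h)) t ne )

nf-▷β : ∀ {t u} → t ▷β u → nf t ▷β? nf u
nf-▷β (base (b-lam {A = A} {t} h)) = nf-β-redex {A = A} {t} h
nf-▷β (base (b-pi1 h)) = inj₂ (base (b-pi1 (nf-preserves-tag diamond h)) , diamond⇒nf≢eps h)
nf-▷β (base (b-pi2 {star} h))    = inj₁ (sym (star⇒nf≡eps h))
nf-▷β (base (b-pi2 {diamond} h)) =
  inj₂ (base (b-pi2 (nf-preserves-tag diamond h)) , diamond⇒nf≢eps h)
nf-▷β {lam s _ t} (lamA r) = mkLam-▷β?-type s (nf t) (nf-▷β r)
nf-▷β {lam s A _} (lamt r) = mkLam-▷β?-body s (nf A) (nf-▷β r)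
nf-▷β {app _ u}   (appl r) = mkApp-▷β?-head (nf u) (nf-▷β r)
nf-▷β {app t _}   (appr r) = mkApp-▷β?-arg (nf t) (nf-▷β r)
nf-▷β {pi s _ B}  (piA r)  = ▷β?-cong (λ X → pi s X (nf B)) piA (λ _ ()) (nf-▷β r)
nf-▷β {pi s A _}  (piB r)  = ▷β?-cong (pi s (nf A)) piB (λ _ ()) (nf-▷β r)
nf-▷β {sig s s' _ B} (sigA r) = ▷β?-cong (λ X → sig s s' X (nf B)) sigA (λ _ ()) (nf-▷β r)
nf-▷β {sig s s' A _} (sigB r) = ▷β?-cong (sig s s' (nf A)) sigB (λ _ ()) (nf-▷β r)
nf-▷β {pair _ b s s' A B} (paira r) =
  ▷β?-cong (λ X → pair X (nf b) s s' (nf A) (nf B)) paira (λ _ ()) (nf-▷β r)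
nf-▷β {pair a _ s s' A B} (pairb r) =
  ▷β?-cong (λ X → pair (nf a) X s s' (nf A) (nf B)) pairb (λ _ ()) (nf-▷β r)
nf-▷β {pair a b s s' _ B} (pairA r) =
  ▷β?-cong (λ X → pair (nf a) (nf b) s s' X (nf B)) pairA (λ _ ()) (nf-▷β r)
nf-▷β {pair a b s s' A _} (pairB r) =
  ▷β?-cong (pair (nf a) (nf b) s s' (nf A)) pairB (λ _ ()) (nf-▷β r)
nf-▷β (pi1c r) = ▷β?-cong pi1 pi1c (λ _ ()) (nf-▷β r)
nf-▷β {pi2 star _}    (pi2c r) = inj₁ refl
nf-▷β {pi2 diamond _} (pi2c r) = ▷β?-cong (pi2 diamond) pi2c (λ _ ()) (nf-▷β r)

≡⇒=β : ∀ {a b} → a ≡ b → a =β b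
≡⇒=β refl = ε

nf-▷βε : ∀ {x y} → x ▷βε y → nf x =β nf y
nf-▷βε r with ▷βε-split r
... | inj₂ rε = ≡⇒=β (nf-▷ε rε)
... | inj₁ rβ with nf-▷β rβ
...   | inj₁ e        = ≡⇒=β e
...   | inj₂ (r' , _) = fwd r' ◅ ε

lemma3p6 : ∀ (t₁ t₂ t₁' t₂' : Term) →
    t₁ ▷ε* t₁' → ε-normal t₁' →
    t₂ ▷ε* t₂' → ε-normal t₂' →
    (t₁ =βε t₂) ⇔ (t₁' =β t₂')
lemma3p6 t₁ t₂ t₁' t₂' r₁ normal₁ r₂ normal₂ = mk⇔ to from
  where
  to : t₁ =βε t₂ → t₁' =β t₂'
  to conv rewrite ε-normal-form≡nf r₁ normal₁ | ε-normal-form≡nf r₂ normal₂ =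
    EqClosure-gfold (isEquivalence _▷β_) nf nf-▷βε conv
  from : t₁' =β t₂' → t₁ =βε t₂
  from conv = ▷ε*⇒=βε r₁ ◅◅ EqClosure-gmap (λ x → x) (Ctx-map be-β) conv
                         ◅◅ symmetric _▷βε_ (▷ε*⇒=βε r₂)
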